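{- There exists an infinite family of strings $w$, with lengths $n=|w|$ unbounded over the family, such that $e(w^R)-e(w)=n-2$ for every $w$ in the family (in particular $\Theta(n)$).
   Context: For $w=w[1]\cdots w[n]$, $w^R=w[n]\cdots w[1]$. $e(w)$ denotes the number of edges of the compact directed acyclic word graph (CDAWG) of $w$; equivalently $e(w)=|E_r(w)|$, where $E_r(w)=\{xa : a \text{ a symbol},\ xa \text{ a substring of } w,\ x \text{ right-maximal in } w\}$, and a substring $x$ of $w$ (possibly empty) is right-maximal in $w$ if either $xa$ and $xb$ are both substrings of $w$ for some distinct symbols $a\neq b$, or $x$ is a suffix of $w$ and $xa$ is a substring of $w$ for some symbol $a$. -}

module Defs where

open import Data.Nat using (ℕ)
open import Data.List using (List; _++_; _∷ʳ_; length)
open import Data.List.Membership.Propositional using (_∈_)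
open import Data.List.Relation.Unary.Unique.Propositional using (Unique)
open import Data.Product using (Σ; ∃; ∃-syntax; _×_)
open import Data.Sum using (_⊎_)
open import Relation.Binary.PropositionalEquality using (_≡_; _≢_)
open import Function.Bundles using (_⇔_)

Symbol : Set
Symbol = ℕ

Word : Set
Word = List Symbol

Substring : Word → Word → Set
Substring x w = ∃[ u ] ∃[ v ] (u ++ x ++ v ≡ w)

Suffix : Word → Word → Set
Suffix x w = ∃[ u ] (u ++ x ≡ w)

RightMaximal : Word → Word → Set
RightMaximal w x =
  (∃[ a ] ∃[ b ] (a ≢ b × Substring (x ∷ʳ a) w × Substring (x ∷ʳ b) w))
  ⊎ (Suffix x w × ∃[ a ] Substring (x ∷ʳ a) w)

Er : Word → Word → Set
Er w y = ∃[ x ] ∃[ a ] (y ≡ x ∷ʳ a × Substring y w × RightMaximal w x)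

HasCard : (Word → Set) → ℕ → Set
HasCard P k = Σ (List Word) λ ys → Unique ys × (∀ y → (y ∈ ys) ⇔ P y) × length ys ≡ k

-- e(w) = k  (number of CDAWG edges of w, i.e. |E_r(w)|)
EdgeCount : Word → ℕ → Set
EdgeCount w k = HasCard (Er w) k

{-# OPTIONS --safe #-}
module Submission where

open import Defs
open import Data.Empty using (⊥-elim)
open import Data.Nat using (ℕ; zero; suc; _+_; _≤_; _<_; z≤n; s≤s; _≤′_; ≤′-refl; ≤′-step)
open import Data.Nat.Properties
  using (suc-injective; <⇒≢; <⇒≤; m≤n⇒m≤1+n; m≤n⇒m<n∨m≡n; n≤1+n; +-comm; ≤⇒≤′)
open import Data.Integer using (+_; _-_; _⊖_)
open import Data.Integer.Properties using ([+m]-[+n]≡m⊖n; [1+m]⊖[1+n]≡m⊖n; +-cancelˡ-⊖)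
open import Data.List using ([]; _∷_; _++_; _∷ʳ_; length; reverse; replicate; applyUpTo)
open import Data.List.Properties
  using (∷-injectiveˡ; ∷-injectiveʳ; ∷ʳ-injective; ++-assoc; ++-identityʳ; ++-conicalˡ; ++-conicalʳ;
         length-++; length-replicate; length-applyUpTo; unfold-reverse)
open import Data.List.Membership.Propositional.Properties using (∈-applyUpTo⁺; ∈-applyUpTo⁻; ++-∈⇔)
open import Data.List.Relation.Binary.Disjoint.Propositional using (Disjoint)
open import Data.List.Relation.Unary.All using ([])
open import Data.List.Relation.Unary.AllPairs using ([]; _∷_)
open import Data.List.Relation.Unary.Any using (here; there)
open import Data.List.Relation.Unary.Unique.Propositional.Properties using (applyUpTo⁺₁; ++⁺)
open import Data.Product using (∃-syntax; _×_; _,_; proj₁; proj₂)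
open import Data.Sum using (_⊎_; inj₁; inj₂)
import Data.Sum as Sum
open import Data.Sum.Function.Propositional using (_⊎-⇔_)
open import Function using (_∘_)
open import Function.Bundles using (_⇔_; mk⇔; Equivalence)
open import Function.Definitions using (Injective)
import Function.Properties.Equivalence as ⇔
open import Relation.Nullary using (¬_)
open import Relation.Binary.PropositionalEquality
  using (_≡_; _≢_; refl; sym; trans; cong; cong₂; subst; module ≡-Reasoning)

-- For w = b aᵏ (a ≠ b, k ≥ 1) the only right-maximal factors are ε and the proper suffixes
-- aⁱ (i < k), which are right-maximal only because they are suffixes; hence
-- E_r(w) = {b} ∪ {aⁱ⁺¹ : i < k} and e(w) = k + 1. In wᴿ = aᵏb each aⁱ with i < k is
-- followed both by a and by b, while aᵏ is followed only by b and is no suffix; hence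
-- E_r(wᴿ) = {aⁱ⁺¹ : i < k} ∪ {aⁱb : i < k} and e(wᴿ) = 2k = e(w) + |w| − 2.

ImageUpTo : (ℕ → Word) → ℕ → Word → Set
ImageUpTo f n y = ∃[ i ] i < n × y ≡ f i

imageUpTo-suc : ∀ {f n y} → ImageUpTo f n y → ImageUpTo f (suc n) y
imageUpTo-suc (i , i<n , eq) = i , m≤n⇒m≤1+n i<n , eq

HasCard-cong : ∀ {P Q : Word → Set} {n} → (∀ y → P y ⇔ Q y) → HasCard P n → HasCard Q n
HasCard-cong P⇔Q (ys , unique , ∈⇔P , len) = ys , unique , (λ y → ⇔.trans (∈⇔P y) (P⇔Q y)) , len

HasCard-singleton : ∀ w → HasCard (_≡ w) 1
HasCard-singleton w = w ∷ [] , [] ∷ [] , (λ y → mk⇔ (λ { (here eq) → eq ; (there ()) }) here) , refl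

HasCard-⊎ : ∀ {P Q : Word → Set} {m n} → HasCard P m → HasCard Q n → (∀ y → P y → ¬ Q y) →
            HasCard (λ y → P y ⊎ Q y) (m + n)
HasCard-⊎ (xs , uxs , ∈⇔P , lenxs) (ys , uys , ∈⇔Q , lenys) disjoint =
  xs ++ ys , ++⁺ uxs uys xs#ys , (λ y → ⇔.trans ++-∈⇔ (∈⇔P y ⊎-⇔ ∈⇔Q y)) ,
  trans (length-++ xs) (cong₂ _+_ lenxs lenys)
  where
  xs#ys : Disjoint xs ys
  xs#ys (y∈xs , y∈ys) = disjoint _ (Equivalence.to (∈⇔P _) y∈xs) (Equivalence.to (∈⇔Q _) y∈ys)

HasCard-imageUpTo : ∀ {f} n → Injective _≡_ _≡_ f → HasCard (ImageUpTo f n) n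
HasCard-imageUpTo {f} n f-injective =
  applyUpTo f n ,
  applyUpTo⁺₁ f n (λ i<j _ fi≡fj → <⇒≢ i<j (f-injective fi≡fj)) ,
  (λ y → mk⇔ (∈-applyUpTo⁻ f) (λ { (i , i<n , refl) → ∈-applyUpTo⁺ f i<n })) ,
  length-applyUpTo f n

∷ʳ≢[] : ∀ (xs : Word) {c} → xs ∷ʳ c ≢ []
∷ʳ≢[] []      ()
∷ʳ≢[] (_ ∷ _) ()

Prefix : Word → Word → Set
Prefix x w = ∃[ v ] (x ++ v ≡ w)

prefix⇒substring : ∀ {x w} → Prefix x w → Substring x w
prefix⇒substring (v , eq) = [] , v , eq

suffix⇒substring : ∀ {x w} → Suffix x w → Substring x w
suffix⇒substring {x} (u , eq) = u , [] , trans (cong (u ++_) (++-identityʳ x)) eq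

prefix-∷ʳ : ∀ {x w} c → Prefix x w → Prefix x (w ∷ʳ c)
prefix-∷ʳ {x} c (v , eq) = v ∷ʳ c , trans (sym (++-assoc x v (c ∷ []))) (cong (_∷ʳ c) eq)

suffix-∷ʳ : ∀ {x w} c → Suffix x w → Suffix (x ∷ʳ c) (w ∷ʳ c)
suffix-∷ʳ {x} c (u , eq) = u , trans (sym (++-assoc u x (c ∷ []))) (cong (_∷ʳ c) eq)

suffix-∷ : ∀ {x w} c → Suffix x w → Suffix x (c ∷ w)
suffix-∷ c (u , eq) = c ∷ u , cong (c ∷_) eq

[]-suffix : ∀ w → Suffix [] w
[]-suffix w = w , ++-identityʳ w

unique-extension⇒¬rightMaximal : ∀ {w x} d → (∀ {c} → Substring (x ∷ʳ c) w → c ≡ d) →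
                                  ¬ Suffix x w → ¬ RightMaximal w x
unique-extension⇒¬rightMaximal d extension≡d _ (inj₁ (c , c′ , c≢c′ , xc , xc′)) =
  c≢c′ (trans (extension≡d xc) (sym (extension≡d xc′)))
unique-extension⇒¬rightMaximal d _ ¬suffix (inj₂ (suffix , _)) = ¬suffix suffix

module _ {a : Symbol} where

  replicate-suc-∷ʳ : ∀ n → replicate (suc n) a ≡ replicate n a ∷ʳ a
  replicate-suc-∷ʳ zero    = refl
  replicate-suc-∷ʳ (suc n) = cong (a ∷_) (replicate-suc-∷ʳ n)

  reverse-replicate : ∀ n → reverse (replicate n a) ≡ replicate n a
  reverse-replicate zero    = refl
  reverse-replicate (suc n) = begin
    reverse (a ∷ replicate n a)  ≡⟨ unfold-reverse a (replicate n a) ⟩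
    reverse (replicate n a) ∷ʳ a ≡⟨ cong (_∷ʳ a) (reverse-replicate n) ⟩
    replicate n a ∷ʳ a           ≡⟨ replicate-suc-∷ʳ n ⟨
    replicate (suc n) a          ∎
    where open ≡-Reasoning

  replicate-injective : Injective _≡_ _≡_ (λ n → replicate n a)
  replicate-injective {m} {n} eq =
    trans (sym (length-replicate m)) (trans (cong length eq) (length-replicate n))

  ∷ʳ≡replicate⇒≡ : ∀ (xs : Word) {c} n → xs ∷ʳ c ≡ replicate n a → c ≡ a
  ∷ʳ≡replicate⇒≡ xs zero    eq = ⊥-elim (∷ʳ≢[] xs eq)
  ∷ʳ≡replicate⇒≡ xs (suc n) eq = proj₂ (∷ʳ-injective xs (replicate n a) (trans eq (replicate-suc-∷ʳ n)))

  replicate-∷ʳ≢shorter : ∀ {i k} c → i ≤ k → replicate k a ∷ʳ c ≢ replicate i a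
  replicate-∷ʳ≢shorter c z≤n       = ∷ʳ≢[] (replicate _ a)
  replicate-∷ʳ≢shorter c (s≤s i≤k) = replicate-∷ʳ≢shorter c i≤k ∘ ∷-injectiveʳ

  replicate-prefix : ∀ {i k} → i ≤ k → Prefix (replicate i a) (replicate k a)
  replicate-prefix {k = k} z≤n = replicate k a , refl
  replicate-prefix (s≤s i≤k) with v , eq ← replicate-prefix i≤k = v , cong (a ∷_) eq

  replicate-suffix : ∀ {i k} → i ≤ k → Suffix (replicate i a) (replicate k a)
  replicate-suffix = suffix′ ∘ ≤⇒≤′
    where
    suffix′ : ∀ {i k} → i ≤′ k → Suffix (replicate i a) (replicate k a)
    suffix′ ≤′-refl        = [] , refl
    suffix′ (≤′-step i≤′k) = suffix-∷ a (suffix′ i≤′k)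

  replicate-substring-of-replicate-∷ʳ : ∀ {i k b} → i ≤ k → Substring (replicate i a) (replicate k a ∷ʳ b)
  replicate-substring-of-replicate-∷ʳ i≤k = prefix⇒substring (prefix-∷ʳ _ (replicate-prefix i≤k))

  replicate-∷ʳ-substring-of-replicate-∷ʳ : ∀ {i k b} → i ≤ k →
                                            Substring (replicate i a ∷ʳ b) (replicate k a ∷ʳ b)
  replicate-∷ʳ-substring-of-replicate-∷ʳ i≤k = suffix⇒substring (suffix-∷ʳ _ (replicate-suffix i≤k))

  prefix-of-replicate : ∀ k {y} → Prefix y (replicate k a) → ImageUpTo (λ i → replicate i a) (suc k) y
  prefix-of-replicate k       {[]}    _        = 0 , s≤s z≤n , refl
  prefix-of-replicate (suc k) {_ ∷ _} (v , eq)
    with i , i<1+k , y≡aⁱ ← prefix-of-replicate k (v , ∷-injectiveʳ eq) =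
    suc i , s≤s i<1+k , cong₂ _∷_ (∷-injectiveˡ eq) y≡aⁱ

  substring-of-replicate : ∀ k {y} → Substring y (replicate k a) →
                           ImageUpTo (λ i → replicate i a) (suc k) y
  substring-of-replicate k       ([]    , v , eq) = prefix-of-replicate k (v , eq)
  substring-of-replicate (suc k) (_ ∷ u , v , eq) =
    imageUpTo-suc (substring-of-replicate k (u , v , ∷-injectiveʳ eq))

  substring-of-∷-replicate : ∀ k {b y} → Substring y (b ∷ replicate k a) →
                             ImageUpTo (λ i → replicate i a) (suc k) y ⊎
                             ImageUpTo (λ i → b ∷ replicate i a) (suc k) y
  substring-of-∷-replicate k {y = []}    ([]    , v , eq) = inj₁ (0 , s≤s z≤n , refl)
  substring-of-∷-replicate k {y = _ ∷ _} ([]    , v , eq)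
    with i , i<1+k , y≡aⁱ ← prefix-of-replicate k (v , ∷-injectiveʳ eq) =
    inj₂ (i , i<1+k , cong₂ _∷_ (∷-injectiveˡ eq) y≡aⁱ)
  substring-of-∷-replicate k              (_ ∷ u , v , eq) =
    inj₁ (substring-of-replicate k (u , v , ∷-injectiveʳ eq))

  prefix-of-replicate-∷ʳ : ∀ k {b y} → Prefix y (replicate k a ∷ʳ b) →
                           ImageUpTo (λ i → replicate i a) (suc k) y ⊎
                           ImageUpTo (λ i → replicate i a ∷ʳ b) (suc k) y
  prefix-of-replicate-∷ʳ k       {y = []}    _        = inj₁ (0 , s≤s z≤n , refl)
  prefix-of-replicate-∷ʳ zero    {y = _ ∷ y} (v , eq) =
    inj₂ (0 , s≤s z≤n , cong₂ _∷_ (∷-injectiveˡ eq) (++-conicalˡ y v (∷-injectiveʳ eq)))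
  prefix-of-replicate-∷ʳ (suc k) {y = _ ∷ _} (v , eq)
    with prefix-of-replicate-∷ʳ k (v , ∷-injectiveʳ eq)
  ... | inj₁ (i , i<1+k , y≡aⁱ)  = inj₁ (suc i , s≤s i<1+k , cong₂ _∷_ (∷-injectiveˡ eq) y≡aⁱ)
  ... | inj₂ (i , i<1+k , y≡aⁱb) = inj₂ (suc i , s≤s i<1+k , cong₂ _∷_ (∷-injectiveˡ eq) y≡aⁱb)

  substring-of-replicate-∷ʳ : ∀ k {b y} → Substring y (replicate k a ∷ʳ b) →
                              ImageUpTo (λ i → replicate i a) (suc k) y ⊎
                              ImageUpTo (λ i → replicate i a ∷ʳ b) (suc k) y
  substring-of-replicate-∷ʳ k       ([]    , v , eq) = prefix-of-replicate-∷ʳ k (v , eq)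
  substring-of-replicate-∷ʳ zero    {y = y} (_ ∷ u , v , eq) =
    inj₁ (0 , s≤s z≤n , ++-conicalˡ y v (++-conicalʳ u (y ++ v) (∷-injectiveʳ eq)))
  substring-of-replicate-∷ʳ (suc k) (_ ∷ u , v , eq) =
    Sum.map imageUpTo-suc imageUpTo-suc (substring-of-replicate-∷ʳ k (u , v , ∷-injectiveʳ eq))

  replicate-∷ʳ-extension : ∀ k {b c} → Substring (replicate k a ∷ʳ c) (replicate k a ∷ʳ b) → c ≡ b
  replicate-∷ʳ-extension k {c = c} aᵏc with substring-of-replicate-∷ʳ k aᵏc
  ... | inj₁ (i , s≤s i≤k , eq) = ⊥-elim (replicate-∷ʳ≢shorter c i≤k eq)
  ... | inj₂ (i , _       , eq) = proj₂ (∷ʳ-injective (replicate k a) (replicate i a) eq)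

module _ {a b : Symbol} (a≢b : a ≢ b) where

  replicate≢replicate-∷ʳ : ∀ i j → replicate i a ≢ replicate j a ∷ʳ b
  replicate≢replicate-∷ʳ zero    zero    ()
  replicate≢replicate-∷ʳ zero    (suc j) ()
  replicate≢replicate-∷ʳ (suc i) zero    eq = a≢b (∷-injectiveˡ eq)
  replicate≢replicate-∷ʳ (suc i) (suc j) eq = replicate≢replicate-∷ʳ i j (∷-injectiveʳ eq)

  replicate-rightMaximal-in-replicate-∷ʳ : ∀ {i k} → i < k →
                                            RightMaximal (replicate k a ∷ʳ b) (replicate i a)
  replicate-rightMaximal-in-replicate-∷ʳ {i} i<k = inj₁ (a , b , a≢b , aⁱa , aⁱb)
    where
    aⁱa : Substring (replicate i a ∷ʳ a) (replicate _ a ∷ʳ b)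
    aⁱa = subst (λ y → Substring y _) (replicate-suc-∷ʳ i) (replicate-substring-of-replicate-∷ʳ i<k)
    aⁱb : Substring (replicate i a ∷ʳ b) (replicate _ a ∷ʳ b)
    aⁱb = replicate-∷ʳ-substring-of-replicate-∷ʳ (<⇒≤ i<k)

  ¬suffix-replicate-∷ʳ : ∀ j k → ¬ Suffix (replicate (suc j) a) (replicate k a ∷ʳ b)
  ¬suffix-replicate-∷ʳ j k (u , eq) =
    a≢b (proj₂ (∷ʳ-injective (u ++ replicate j a) (replicate k a) (begin
      (u ++ replicate j a) ∷ʳ a ≡⟨ ++-assoc u (replicate j a) (a ∷ []) ⟩
      u ++ (replicate j a ∷ʳ a) ≡⟨ cong (u ++_) (replicate-suc-∷ʳ j) ⟨
      u ++ replicate (suc j) a  ≡⟨ eq ⟩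
      replicate k a ∷ʳ b        ∎)))
    where open ≡-Reasoning

  Er-replicate-∷ʳ : ∀ j y → Er (replicate (suc j) a ∷ʳ b) y ⇔
                            (ImageUpTo (λ i → replicate (suc i) a) (suc j) y ⊎
                             ImageUpTo (λ i → replicate i a ∷ʳ b) (suc j) y)
  Er-replicate-∷ʳ j y = mk⇔ to from
    where
    k : ℕ
    k = suc j

    ¬rightMaximal : ¬ RightMaximal (replicate k a ∷ʳ b) (replicate k a)
    ¬rightMaximal = unique-extension⇒¬rightMaximal b (replicate-∷ʳ-extension k) (¬suffix-replicate-∷ʳ j k)

    to : Er (replicate k a ∷ʳ b) y →
         ImageUpTo (λ i → replicate (suc i) a) k y ⊎ ImageUpTo (λ i → replicate i a ∷ʳ b) k y
    to (x , c , refl , xc , x-rightMaximal) with substring-of-replicate-∷ʳ k xc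
    ... | inj₁ (zero  , _         , eq) = ⊥-elim (∷ʳ≢[] x eq)
    ... | inj₁ (suc i , s≤s i<k   , eq) = inj₁ (i , i<k , eq)
    ... | inj₂ (i     , s≤s i≤k   , eq) with ∷ʳ-injective x (replicate i a) eq
    ...   | refl , refl with m≤n⇒m<n∨m≡n i≤k
    ...     | inj₁ i<k  = inj₂ (i , i<k , refl)
    ...     | inj₂ refl = ⊥-elim (¬rightMaximal x-rightMaximal)

    from : ImageUpTo (λ i → replicate (suc i) a) k y ⊎ ImageUpTo (λ i → replicate i a ∷ʳ b) k y →
           Er (replicate k a ∷ʳ b) y
    from (inj₁ (i , i<k , refl)) =
      replicate i a , a , replicate-suc-∷ʳ i ,
      replicate-substring-of-replicate-∷ʳ i<k , replicate-rightMaximal-in-replicate-∷ʳ i<k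
    from (inj₂ (i , i<k , refl)) =
      replicate i a , b , refl ,
      replicate-∷ʳ-substring-of-replicate-∷ʳ (<⇒≤ i<k) , replicate-rightMaximal-in-replicate-∷ʳ i<k

  ∷-replicate-extension : ∀ {i k c} → Substring ((b ∷ replicate i a) ∷ʳ c) (b ∷ replicate k a) → c ≡ a
  ∷-replicate-extension {i} {k} baⁱc with substring-of-∷-replicate k baⁱc
  ... | inj₁ (zero  , _ , ())
  ... | inj₁ (suc _ , _ , eq) = ⊥-elim (a≢b (sym (∷-injectiveˡ eq)))
  ... | inj₂ (j     , _ , eq) = ∷ʳ≡replicate⇒≡ (replicate i a) j (∷-injectiveʳ eq)

  ¬suffix-∷-replicate : ∀ {i k} → i < k → ¬ Suffix (b ∷ replicate i a) (b ∷ replicate k a)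
  ¬suffix-∷-replicate i<k ([] , eq) = <⇒≢ i<k (replicate-injective (∷-injectiveʳ eq))
  ¬suffix-∷-replicate {i} {k} i<k (_ ∷ u , eq)
    with substring-of-replicate k (u , replicate i a , ∷-injectiveʳ eq)
  ... | zero  , _ , ()
  ... | suc _ , _ , b≡aʲ⁺¹ = a≢b (sym (∷-injectiveˡ b≡aʲ⁺¹))

  Er-∷-replicate : ∀ k y → Er (b ∷ replicate k a) y ⇔
                           (y ≡ b ∷ [] ⊎ ImageUpTo (λ i → replicate (suc i) a) k y)
  Er-∷-replicate k y = mk⇔ to from
    where
    to : Er (b ∷ replicate k a) y → y ≡ b ∷ [] ⊎ ImageUpTo (λ i → replicate (suc i) a) k y
    to (x , c , refl , xc , x-rightMaximal) with substring-of-∷-replicate k xc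
    ... | inj₁ (zero  , _       , eq) = ⊥-elim (∷ʳ≢[] x eq)
    ... | inj₁ (suc i , s≤s i<k , eq) = inj₂ (i , i<k , eq)
    ... | inj₂ (zero  , _       , eq) = inj₁ eq
    ... | inj₂ (suc i , s≤s i<k , eq)
      with ∷ʳ-injective x (b ∷ replicate i a) (trans eq (cong (b ∷_) (replicate-suc-∷ʳ i)))
    ...   | refl , refl = ⊥-elim (unique-extension⇒¬rightMaximal a ∷-replicate-extension
                                     (¬suffix-∷-replicate i<k) x-rightMaximal)

    from : y ≡ b ∷ [] ⊎ ImageUpTo (λ i → replicate (suc i) a) k y → Er (b ∷ replicate k a) y
    from (inj₁ refl) =
      [] , b , refl , b-substring , inj₂ ([]-suffix (b ∷ replicate k a) , b , b-substring)
      where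
      b-substring : Substring (b ∷ []) (b ∷ replicate k a)
      b-substring = prefix⇒substring (replicate k a , refl)
    from (inj₂ (i , i<k , refl)) =
      replicate i a , a , replicate-suc-∷ʳ i , aⁱ⁺¹-substring ,
      inj₂ (suffix-∷ b (replicate-suffix (<⇒≤ i<k)) , a ,
            subst (λ z → Substring z (b ∷ replicate k a)) (replicate-suc-∷ʳ i) aⁱ⁺¹-substring)
      where
      aⁱ⁺¹-substring : Substring (replicate (suc i) a) (b ∷ replicate k a)
      aⁱ⁺¹-substring = suffix⇒substring (suffix-∷ b (replicate-suffix i<k))

  edgeCount-replicate-∷ʳ : ∀ j → EdgeCount (replicate (suc j) a ∷ʳ b) (suc j + suc j)
  edgeCount-replicate-∷ʳ j =
    HasCard-cong (λ y → ⇔.sym (Er-replicate-∷ʳ j y))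
      (HasCard-⊎ (HasCard-imageUpTo (suc j) (suc-injective ∘ replicate-injective))
                 (HasCard-imageUpTo (suc j) (replicate-injective ∘ proj₁ ∘ ∷ʳ-injective _ _))
                 (λ { _ (i , _ , refl) (i′ , _ , eq) → replicate≢replicate-∷ʳ (suc i) i′ eq }))

  edgeCount-∷-replicate : ∀ k → EdgeCount (b ∷ replicate k a) (1 + k)
  edgeCount-∷-replicate k =
    HasCard-cong (λ y → ⇔.sym (Er-∷-replicate k y))
      (HasCard-⊎ (HasCard-singleton (b ∷ []))
                 (HasCard-imageUpTo k (suc-injective ∘ replicate-injective))
                 (λ { _ refl (_ , _ , b≡aⁱ⁺¹) → a≢b (sym (∷-injectiveˡ b≡aⁱ⁺¹)) }))

edgeCount-difference : ∀ k → + (k + k) - + suc k ≡ + suc k - + 2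
edgeCount-difference k = begin
  + (k + k) - + suc k ≡⟨ [+m]-[+n]≡m⊖n (k + k) (suc k) ⟩
  (k + k) ⊖ suc k     ≡⟨ cong ((k + k) ⊖_) (+-comm 1 k) ⟩
  (k + k) ⊖ (k + 1)   ≡⟨ +-cancelˡ-⊖ k k 1 ⟩
  k ⊖ 1               ≡⟨ [1+m]⊖[1+n]≡m⊖n k 1 ⟨
  suc k ⊖ 2           ≡⟨ [+m]-[+n]≡m⊖n (suc k) 2 ⟨
  + suc k - + 2       ∎
  where open ≡-Reasoning

propositionB1 : ∀ (m : ℕ) → ∃[ w ] (m ≤ length w × ∃[ eR ] ∃[ e ]
                  (EdgeCount (reverse w) eR × EdgeCount w e
                   × (+ eR - + e ≡ + length w - + 2)))
propositionB1 m =
  w , m≤|w| , k + k , suc k ,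
  subst (λ v → EdgeCount v (k + k)) (sym reverse-w) (edgeCount-replicate-∷ʳ 0≢1 m) ,
  edgeCount-∷-replicate 0≢1 k ,
  trans (edgeCount-difference k) (cong (λ n → + n - + 2) (sym |w|≡1+k))
  where
  k : ℕ
  k = suc m

  w : Word
  w = 1 ∷ replicate k 0

  0≢1 : 0 ≢ 1
  0≢1 ()

  |w|≡1+k : length w ≡ suc k
  |w|≡1+k = cong suc (length-replicate k)

  m≤|w| : m ≤ length w
  m≤|w| = subst (m ≤_) (sym |w|≡1+k) (m≤n⇒m≤1+n (n≤1+n m))

  reverse-w : reverse w ≡ replicate k 0 ∷ʳ 1
  reverse-w = trans (unfold-reverse 1 (replicate k 0)) (cong (_∷ʳ 1) (reverse-replicate k))
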